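{- In the core theory of exceptions $T_{excore}$: (1) for each propagator $a:X\to Y$, either $a$ is pure or there is a pure term $v:X\to P$ such that $a\equiv[\,]_Y\circ\mathtt{tag}\circ v$; and for each propagator $a:X\to\mathbb{0}$ (pure or not) there is a pure term $v:X\to P$ such that $a\equiv\mathtt{tag}\circ v$; (2) for each catcher $f:X\to Y$, either $f$ is a propagator or there are a propagator $a:P\to Y$ and a pure term $u:X\to P$ such that $f\equiv a\circ\mathtt{untag}\circ\mathtt{tag}\circ u$.
   Context: Monadic equational logic $L_{eqn}$ (with empty type): types and terms generated by a signature of unary operations, terms being composable paths (with identities); an empty type $\mathbb{0}$ with a term $[\,]_Y:\mathbb{0}\to Y$ for each $Y$. Rules: $\equiv$ is an equivalence relation; (subs) from $v_1\equiv v_2:Y\to Z$ and $u:X\to Y$ infer $v_1\circ u\equiv v_2\circ u$; (repl) from $v_1\equiv v_2:X\to Y$ and $w:Y\to Z$ infer $w\circ v_1\equiv w\circ v_2$; (initial) every $u:\mathbb{0}\to Y$ satisfies $u\equiv[\,]_Y$. Core logic for exceptions $L_{excore}$: pure part $L_{eqn}$ with a distinguished type $P$. Terms are composites of pure terms and the operations $\mathtt{tag}:P\to\mathbb{0}$ (decoration $(1)$) and $\mathtt{untag}:\mathbb{0}\to P$ (decoration $(2)$); a composite has decoration the maximum of its components'; pure terms have decoration $(0)$; a propagator is a term of decoration at most $(1)$; every term is a catcher. Formulas: strong equations $f\equiv g$ and weak equations $f\sim g$. Rules: for $\equiv$: equivalence, (subs), (repl) for all decorations; for $\sim$: equivalence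 and (repl) for all decorations, (subs) only when the substituted term $u$ is pure; (empty$_\sim$) every $f:\mathbb{0}\to Y$ satisfies $f\sim[\,]_Y$; $f\equiv g$ implies $f\sim g$; (ax) $\mathtt{untag}\circ\mathtt{tag}\sim\mathrm{id}_P$; (eq$_1$) if $f_1\sim f_2$ with $f_1,f_2$ propagators then $f_1\equiv f_2$; (eq$_2$) for $f_1,f_2:X\to Y$, $f_1\sim f_2$ and $f_1\circ[\,]_X\equiv f_2\circ[\,]_X$ imply $f_1\equiv f_2$; (eq$_3$) for $f_1,f_2:\mathbb{0}\to X$, $f_1\circ\mathtt{tag}\sim f_2\circ\mathtt{tag}$ implies $f_1\equiv f_2$; plus the rules of $L_{eqn}$ for pure terms. $T_{excore}$ is the theory (set of formulas closed under the rules) generated by a fixed theory $T_{eqn}$ of $L_{eqn}$; the equations in the claim are theorems of $T_{excore}$. -}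

module Defs where

open import Data.Nat using (ℕ; zero; suc; _⊔_; _≤_)
open import Relation.Binary.PropositionalEquality using (_≡_)

data Ty (B : Set) : Set where
  ⌜_⌝ : B → Ty B
  𝟘   : Ty B

record Signature : Set₁ where
  field
    Base : Set
    pt   : Base
    Op   : Ty Base → Ty Base → Set

module Exc (S : Signature) where
  open Signature S public

  T : Set
  T = Ty Base

  P : T
  P = ⌜ pt ⌝

  data Edge : T → T → Set where
    op    : ∀ {X Y} → Op X Y → Edge X Y
    empty : (Y : T) → Edge 𝟘 Y
    tag   : Edge P 𝟘
    untag : Edge 𝟘 P

  infixr 5 _▸_
  data Tm : T → T → Set where
    idt : ∀ {X} → Tm X X
    _▸_ : ∀ {X Y Z} → Edge Y Z → Tm X Y → Tm X Z

  infixr 9 _∘_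
  _∘_ : ∀ {X Y Z} → Tm Y Z → Tm X Y → Tm X Z
  idt ∘ u = u
  (e ▸ t) ∘ u = e ▸ (t ∘ u)

  ⟨_⟩ : ∀ {X Y} → Edge X Y → Tm X Y
  ⟨ e ⟩ = e ▸ idt

  id : (X : T) → Tm X X
  id X = idt

  [_] : (Y : T) → Tm 𝟘 Y
  [ Y ] = ⟨ empty Y ⟩

  tagₜ : Tm P 𝟘
  tagₜ = ⟨ tag ⟩

  untagₜ : Tm 𝟘 P
  untagₜ = ⟨ untag ⟩

  edeco : ∀ {X Y} → Edge X Y → ℕ
  edeco (op _)    = 0
  edeco (empty _) = 0
  edeco tag       = 1
  edeco untag     = 2

  deco : ∀ {X Y} → Tm X Y → ℕ
  deco idt     = 0
  deco (e ▸ t) = edeco e ⊔ deco t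

  Pure : ∀ {X Y} → Tm X Y → Set
  Pure f = deco f ≡ 0

  Propagator : ∀ {X Y} → Tm X Y → Set
  Propagator f = deco f ≤ 1

  -- (every term is a catcher)

  module Theory (Ax : ∀ {X Y} → Tm X Y → Tm X Y → Set) where
    infix 4 _≡ₛ_ _∼_
    data _≡ₛ_ : ∀ {X Y} → Tm X Y → Tm X Y → Set
    data _∼_  : ∀ {X Y} → Tm X Y → Tm X Y → Set

    data _≡ₛ_ where
      s-ax    : ∀ {X Y} {f g : Tm X Y} → Pure f → Pure g → Ax f g → f ≡ₛ g
      s-refl  : ∀ {X Y} {f : Tm X Y} → f ≡ₛ f
      s-sym   : ∀ {X Y} {f g : Tm X Y} → f ≡ₛ g → g ≡ₛ f
      s-trans : ∀ {X Y} {f g h : Tm X Y} → f ≡ₛ g → g ≡ₛ h → f ≡ₛ h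
      s-subs  : ∀ {X Y Z} {v₁ v₂ : Tm Y Z} (u : Tm X Y) → v₁ ≡ₛ v₂ → v₁ ∘ u ≡ₛ v₂ ∘ u
      s-repl  : ∀ {X Y Z} {v₁ v₂ : Tm X Y} (w : Tm Y Z) → v₁ ≡ₛ v₂ → w ∘ v₁ ≡ₛ w ∘ v₂
      s-initial : ∀ {Y} (u : Tm 𝟘 Y) → Pure u → u ≡ₛ [ Y ]
      eq₁ : ∀ {X Y} {f₁ f₂ : Tm X Y} → Propagator f₁ → Propagator f₂ → f₁ ∼ f₂ → f₁ ≡ₛ f₂
      eq₂ : ∀ {X Y} {f₁ f₂ : Tm X Y} → f₁ ∼ f₂ → f₁ ∘ [ X ] ≡ₛ f₂ ∘ [ X ] → f₁ ≡ₛ f₂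
      eq₃ : ∀ {X} {f₁ f₂ : Tm 𝟘 X} → f₁ ∘ tagₜ ∼ f₂ ∘ tagₜ → f₁ ≡ₛ f₂

    data _∼_ where
      w-refl  : ∀ {X Y} {f : Tm X Y} → f ∼ f
      w-sym   : ∀ {X Y} {f g : Tm X Y} → f ∼ g → g ∼ f
      w-trans : ∀ {X Y} {f g h : Tm X Y} → f ∼ g → g ∼ h → f ∼ h
      w-subs  : ∀ {X Y Z} {v₁ v₂ : Tm Y Z} (u : Tm X Y) → Pure u → v₁ ∼ v₂ → v₁ ∘ u ∼ v₂ ∘ u
      w-repl  : ∀ {X Y Z} {v₁ v₂ : Tm X Y} (w : Tm Y Z) → v₁ ∼ v₂ → w ∘ v₁ ∼ w ∘ v₂
      w-empty : ∀ {Y} (f : Tm 𝟘 Y) → f ∼ [ Y ]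
      s⇒w     : ∀ {X Y} {f g : Tm X Y} → f ≡ₛ g → f ∼ g
      w-ax    : untagₜ ∘ tagₜ ∼ id P

{-# OPTIONS --safe #-}

-- A propagator contains no untag: it is pure up to its first tag, and what
-- follows that tag is a propagator out of 𝟘, hence strongly equal to [ ] by
-- (empty∼) and (eq₁). A catcher is analysed at its untags: each one is
-- preceded by a propagator into 𝟘, i.e. by tag ∘ v with v pure. A second
-- untag collapses onto the first, because untag ∘ tag ∘ v ∘ untag ≡ v ∘ untag
-- follows by (eq₃) from the weak axiom untag ∘ tag ∼ id: precomposed with
-- tag, both sides are weakly equal to v.
module Submission where

open import Defs
open import Data.Empty using (⊥-elim)
open import Data.Nat using (_≤_; _⊔_; z≤n; s≤s)
open import Data.Nat.Properties using (⊔-assoc; ⊔-lub; m⊔n≤o⇒m≤o; m⊔n≤o⇒n≤o; 1+n≰n)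
open import Data.Product using (Σ-syntax; _×_; _,_)
open import Data.Sum using (_⊎_; inj₁; inj₂)
open import Relation.Binary.Bundles using (Setoid)
open import Relation.Binary.PropositionalEquality using (_≡_; refl; sym; trans; cong; cong₂; subst)
import Relation.Binary.Reasoning.Setoid as SetoidReasoning

module ExceptionsCore (S : Signature) (Ax : ∀ {X Y} → Exc.Tm S X Y → Exc.Tm S X Y → Set) where
  open Exc S
  open Theory Ax

  ∘-assoc : ∀ {W X Y Z} (h : Tm Y Z) (g : Tm X Y) (f : Tm W X) → (h ∘ g) ∘ f ≡ h ∘ (g ∘ f)
  ∘-assoc idt     g f = refl
  ∘-assoc (e ▸ h) g f = cong (e ▸_) (∘-assoc h g f)

  ∘-identityʳ : ∀ {X Y} (f : Tm X Y) → f ∘ id X ≡ f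
  ∘-identityʳ idt     = refl
  ∘-identityʳ (e ▸ f) = cong (e ▸_) (∘-identityʳ f)

  deco-∘ : ∀ {X Y Z} (g : Tm Y Z) (f : Tm X Y) → deco (g ∘ f) ≡ deco g ⊔ deco f
  deco-∘ idt     f = refl
  deco-∘ (e ▸ g) f = trans (cong (edeco e ⊔_) (deco-∘ g f)) (sym (⊔-assoc (edeco e) (deco g) (deco f)))

  pure-∘ : ∀ {X Y Z} (g : Tm Y Z) {f : Tm X Y} → Pure g → Pure f → Pure (g ∘ f)
  pure-∘ g {f} pure-g pure-f = trans (deco-∘ g f) (cong₂ _⊔_ pure-g pure-f)

  propagator-∘ : ∀ {X Y Z} (g : Tm Y Z) {f : Tm X Y} → Propagator g → Propagator f → Propagator (g ∘ f)
  propagator-∘ g {f} prop-g prop-f = subst (_≤ 1) (sym (deco-∘ g f)) (⊔-lub prop-g prop-f)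

  pure⇒propagator : ∀ {X Y} (f : Tm X Y) → Pure f → Propagator f
  pure⇒propagator f pure-f = subst (_≤ 1) (sym pure-f) z≤n

  ≡ₛ-setoid : T → T → Setoid _ _
  ≡ₛ-setoid X Y = record
    { Carrier       = Tm X Y
    ; _≈_           = _≡ₛ_
    ; isEquivalence = record { refl = s-refl ; sym = s-sym ; trans = s-trans }
    }

  ≡⇒≡ₛ : ∀ {X Y} {f g : Tm X Y} → f ≡ g → f ≡ₛ g
  ≡⇒≡ₛ {X} {Y} = Setoid.reflexive (≡ₛ-setoid X Y)

  module ≡ₛ-Reasoning {X Y : T} = SetoidReasoning (≡ₛ-setoid X Y)
  open ≡ₛ-Reasoning

  propagator-from-𝟘 : ∀ {Y} (w : Tm 𝟘 Y) → Propagator w → w ≡ₛ [ Y ]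
  propagator-from-𝟘 w prop-w = eq₁ prop-w z≤n (w-empty w)

  id𝟘≡[] : id 𝟘 ≡ₛ [ 𝟘 ]
  id𝟘≡[] = propagator-from-𝟘 (id 𝟘) z≤n

  tag∘[]≡id : tagₜ ∘ [ P ] ≡ₛ id 𝟘
  tag∘[]≡id = s-trans (propagator-from-𝟘 (tagₜ ∘ [ P ]) (s≤s z≤n)) (s-sym id𝟘≡[])

  propagator∘[]∘tag : ∀ {X Y Z} (w : Tm Y Z) {t : Tm X Y} {v : Tm X P} → Propagator w →
                      t ≡ₛ [ Y ] ∘ tagₜ ∘ v → w ∘ t ≡ₛ [ Z ] ∘ tagₜ ∘ v
  propagator∘[]∘tag {Y = Y} {Z} w {t} {v} prop-w t≡ = begin
    w ∘ t                   ≈⟨ s-repl w t≡ ⟩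
    w ∘ [ Y ] ∘ tagₜ ∘ v    ≡⟨ ∘-assoc w [ Y ] (tagₜ ∘ v) ⟨
    (w ∘ [ Y ]) ∘ tagₜ ∘ v  ≈⟨ s-subs (tagₜ ∘ v) (propagator-from-𝟘 (w ∘ [ Y ]) (propagator-∘ w prop-w z≤n)) ⟩
    [ Z ] ∘ tagₜ ∘ v        ∎

  g∘untag∘tag∼g : ∀ {Y} (g : Tm P Y) → (g ∘ untagₜ) ∘ tagₜ ∼ g
  g∘untag∘tag∼g g = w-trans (≡⇒∼ (∘-assoc g untagₜ tagₜ))
                            (w-trans (w-repl g w-ax) (≡⇒∼ (∘-identityʳ g)))
    where
    ≡⇒∼ : ∀ {X Y} {f g : Tm X Y} → f ≡ g → f ∼ g
    ≡⇒∼ refl = w-refl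

  untag∘tag∘v∘untag≡v∘untag : (v : Tm P P) → Pure v → untagₜ ∘ tagₜ ∘ v ∘ untagₜ ≡ₛ v ∘ untagₜ
  untag∘tag∘v∘untag≡v∘untag v pure-v = eq₃
    (w-trans (w-repl (untagₜ ∘ tagₜ) (g∘untag∘tag∼g v))
    (w-trans (w-subs v pure-v w-ax)
             (w-sym (g∘untag∘tag∼g v))))

  PropagatorForm : ∀ {X Y} → Tm X Y → Set
  PropagatorForm {X} {Y} a = Pure a ⊎ (Σ[ v ∈ Tm X P ] (Pure v × (a ≡ₛ [ Y ] ∘ tagₜ ∘ v)))

  pure∘-propagator-form : ∀ {X Y Z} (w : Tm Y Z) {t : Tm X Y} → Pure w → PropagatorForm t → PropagatorForm (w ∘ t)
  pure∘-propagator-form w pure-w (inj₁ pure-t) = inj₁ (pure-∘ w pure-w pure-t)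
  pure∘-propagator-form w pure-w (inj₂ (v , pure-v , t≡)) =
    inj₂ (v , pure-v , propagator∘[]∘tag w (pure⇒propagator w pure-w) t≡)

  propagator-form : ∀ {X Y} (a : Tm X Y) → Propagator a → PropagatorForm a
  propagator-form idt           _ = inj₁ refl
  propagator-form (op o ▸ t)    p = pure∘-propagator-form ⟨ op o ⟩ refl (propagator-form t p)
  propagator-form (empty Z ▸ t) p = pure∘-propagator-form ⟨ empty Z ⟩ refl (propagator-form t p)
  propagator-form (tag ▸ t)     p with propagator-form t (m⊔n≤o⇒n≤o 1 (deco t) p)
  ... | inj₁ pure-t            = inj₂ (t , pure-t , s-subs (tagₜ ∘ t) id𝟘≡[])
  ... | inj₂ (v , pure-v , t≡) = inj₂ (v , pure-v , propagator∘[]∘tag tagₜ (s≤s z≤n) t≡)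
  propagator-form (untag ▸ t)   p = ⊥-elim (1+n≰n (m⊔n≤o⇒m≤o 2 (deco t) p))

  propagator-into-𝟘-form : ∀ {X} (a : Tm X 𝟘) → Propagator a → Σ[ v ∈ Tm X P ] (Pure v × (a ≡ₛ tagₜ ∘ v))
  propagator-into-𝟘-form a prop-a with propagator-form a prop-a
  ... | inj₁ pure-a            = [ P ] ∘ a , pure-a , s-subs a (s-sym tag∘[]≡id)
  ... | inj₂ (v , pure-v , a≡) = v , pure-v , s-trans a≡ (s-subs (tagₜ ∘ v) (s-sym id𝟘≡[]))

  CatcherForm : ∀ {X Y} → Tm X Y → Set
  CatcherForm {X} {Y} f = Propagator f ⊎
    (Σ[ a ∈ Tm P Y ] Σ[ u ∈ Tm X P ] (Propagator a × Pure u × (f ≡ₛ a ∘ untagₜ ∘ tagₜ ∘ u)))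

  propagator∘-catcher-form : ∀ {X Y Z} (w : Tm Y Z) {t : Tm X Y} → Propagator w → CatcherForm t → CatcherForm (w ∘ t)
  propagator∘-catcher-form w prop-w (inj₁ prop-t) = inj₁ (propagator-∘ w prop-w prop-t)
  propagator∘-catcher-form w {t} prop-w (inj₂ (a , u , prop-a , pure-u , t≡)) =
    inj₂ (w ∘ a , u , propagator-∘ w prop-w prop-a , pure-u , w∘t≡)
    where
    w∘t≡ : w ∘ t ≡ₛ (w ∘ a) ∘ untagₜ ∘ tagₜ ∘ u
    w∘t≡ = s-trans (s-repl w t≡) (≡⇒≡ₛ (sym (∘-assoc w a (untagₜ ∘ tagₜ ∘ u))))

  untag∘-catcher-form : ∀ {X} (t : Tm X 𝟘) → CatcherForm t → CatcherForm (untagₜ ∘ t)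
  untag∘-catcher-form t (inj₁ prop-t) with propagator-into-𝟘-form t prop-t
  ... | v , pure-v , t≡ = inj₂ (id P , v , z≤n , pure-v , s-repl untagₜ t≡)
  untag∘-catcher-form t (inj₂ (a , u , prop-a , pure-u , t≡)) with propagator-into-𝟘-form a prop-a
  ... | v , pure-v , a≡ = inj₂ (v , u , pure⇒propagator v pure-v , pure-u , (begin
    untagₜ ∘ t                                  ≈⟨ s-repl untagₜ (s-trans t≡ (s-subs (untagₜ ∘ tagₜ ∘ u) a≡)) ⟩
    untagₜ ∘ tagₜ ∘ v ∘ untagₜ ∘ tagₜ ∘ u       ≡⟨ cong (λ g → untagₜ ∘ tagₜ ∘ g) (∘-assoc v untagₜ (tagₜ ∘ u)) ⟨
    (untagₜ ∘ tagₜ ∘ v ∘ untagₜ) ∘ tagₜ ∘ u     ≈⟨ s-subs (tagₜ ∘ u) (untag∘tag∘v∘untag≡v∘untag v pure-v) ⟩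
    (v ∘ untagₜ) ∘ tagₜ ∘ u                     ≡⟨ ∘-assoc v untagₜ (tagₜ ∘ u) ⟩
    v ∘ untagₜ ∘ tagₜ ∘ u                       ∎))

  catcher-form : ∀ {X Y} (f : Tm X Y) → CatcherForm f
  catcher-form idt           = inj₁ z≤n
  catcher-form (op o ▸ t)    = propagator∘-catcher-form ⟨ op o ⟩ z≤n (catcher-form t)
  catcher-form (empty Z ▸ t) = propagator∘-catcher-form ⟨ empty Z ⟩ z≤n (catcher-form t)
  catcher-form (tag ▸ t)     = propagator∘-catcher-form tagₜ (s≤s z≤n) (catcher-form t)
  catcher-form (untag ▸ t)   = untag∘-catcher-form t (catcher-form t)

proposition4p4 : (S : Signature)
    (Ax : ∀ {X Y} → Exc.Tm S X Y → Exc.Tm S X Y → Set) →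
    let open Exc S
        open Theory Ax
    in ((∀ {X Y} (a : Tm X Y) → Propagator a →
          Pure a ⊎ (Σ[ v ∈ Tm X P ] (Pure v × (a ≡ₛ [ Y ] ∘ tagₜ ∘ v))))
       × (∀ {X} (a : Tm X 𝟘) → Propagator a →
          Σ[ v ∈ Tm X P ] (Pure v × (a ≡ₛ tagₜ ∘ v))))
     × (∀ {X Y} (f : Tm X Y) →
          Propagator f ⊎
          (Σ[ a ∈ Tm P Y ] Σ[ u ∈ Tm X P ]
             (Propagator a × Pure u × (f ≡ₛ a ∘ untagₜ ∘ tagₜ ∘ u))))
proposition4p4 S Ax = (propagator-form , propagator-into-𝟘-form) , catcher-form
  where open ExceptionsCore S Ax
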